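{- Let $X=(V,E,T)$ be a finite $2$-dimensional $(k_0,k_1)$-regular simplicial complex which is an $(\epsilon,\mu)$-cosystolic expander, and assume $|V|\ge\frac{3}{\mu}$. Then for every subset of edges $F\subseteq E$ and every vertex $v\in V$, $$\mathrm{dist}\big(F_v,\,Z^1(X)\setminus B^1(X)\big)\ge\frac{k_0}{2}.$$
   Context: A finite $2$-dimensional simplicial complex $X=(V,E,T)$ consists of a finite vertex set $V$, a set $E$ of $2$-element subsets of $V$ and a set $T$ of $3$-element subsets of $V$ such that every $2$-element subset of a triangle belongs to $E$; $X(0)=V$, $X(1)=E$, $X(2)=T$. $X$ is $(k_0,k_1)$-regular if every vertex lies in exactly $k_0$ edges and every edge lies in exactly $k_1$ triangles. For $S\subseteq V$, $\delta(S)$ is the set of edges with exactly one endpoint in $S$; for $F\subseteq E$, $\delta(F)$ is the set of triangles containing an odd number of edges of $F$. $B^0(X)=\{\emptyset,V\}$, $Z^0(X)=\{S\subseteq V:\delta(S)=\emptyset\}$, $B^1(X)=\{\delta(S):S\subseteq V\}$, $Z^1(X)=\{F\subseteq E:\delta(F)=\emptyset\}$. $\mathrm{dist}(A,B)=|A\setminus B|+|B\setminus A|$ and $\mathrm{dist}(A,\mathcal C)=\min_{C\in\mathcal C}\mathrm{dist}(A,C)$ (taken to be $+\infty$ if $\mathcal C$ is empty). $X$ is an $(\epsilon,\mu)$-cosystolic expander ($\epsilon,\mu>0$) if for every $i\in\{0,1\}$ and every $S\subseteq X(i)$: if $\delta(S)=\emptyset$ then $S\in B^i(X)$ or $|S|\ge\mu|X(i)|$;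 otherwise $|\delta(S)|\ge\epsilon k_i\,\mathrm{dist}(S,Z^i(X))$. The local view of $v$ with respect to $F$ is $F_v=\{e\in F: v\in e\}$.
   Formalization: The cosystolic expansion parameters ε and μ take values in the positive rationals. -}

module Defs where

open import Data.Nat using (ℕ; zero; suc; _≤_)
open import Data.Bool using (Bool; true; false; _∧_; _∨_; _xor_; if_then_else_)
open import Data.Fin using (Fin)
open import Data.Fin.Properties using () renaming (_≟_ to _≟F_)
open import Data.Fin.Subset using (Subset; ∣_∣; ⊥; ⊤)
open import Data.Vec using (Vec; tabulate; lookup; zipWith; foldr)
open import Data.Product using (Σ; _×_; _,_; ∃)
open import Data.Sum using (_⊎_)
open import Relation.Nullary using (¬_)
open import Relation.Nullary.Decidable using (⌊_⌋)
open import Relation.Binary.PropositionalEquality using (_≡_; _≢_)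
open import Data.Integer using (+_)
open import Data.Rational using (ℚ; 0ℚ; _/_; _*_; _÷_; _<_; >-nonZero)
  renaming (_≤_ to _≤ℚ_)

ℕ→ℚ : ℕ → ℚ
ℕ→ℚ n = + n / 1

-- Edge e is the 2-element set {src e, tgt e}; triangle τ is the
-- 3-element set {v₁ τ, v₂ τ, v₃ τ}.  Distinct indices denote distinct
-- subsets (injectivity), so X(1), X(2) are genuine sets of subsets.

_∈?_ : {n : ℕ} → Fin n → Fin n × Fin n → Bool
v ∈? (a , b) = ⌊ v ≟F a ⌋ ∨ ⌊ v ≟F b ⌋

_∈³?_ : {n : ℕ} → Fin n → Fin n × Fin n × Fin n → Bool
v ∈³? (a , b , c) = ⌊ v ≟F a ⌋ ∨ (⌊ v ≟F b ⌋ ∨ ⌊ v ≟F c ⌋)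

record Complex : Set where
  field
    n m t   : ℕ
    edge    : Fin m → Fin n × Fin n
    tri     : Fin t → Fin n × Fin n × Fin n
    edge-distinct : ∀ e → Data.Product.proj₁ (edge e) ≢ Data.Product.proj₂ (edge e)
    edge-inj : ∀ e e' → (∀ v → (v ∈? edge e) ≡ (v ∈? edge e')) → e ≡ e'
    tri-distinct : ∀ τ → let (a , b , c) = tri τ in (a ≢ b) × (a ≢ c) × (b ≢ c)
    tri-inj : ∀ τ τ' → (∀ v → (v ∈³? tri τ) ≡ (v ∈³? tri τ')) → τ ≡ τ'
    tri-closed : ∀ τ (a b : Fin n) → a ≢ b → (a ∈³? tri τ) ≡ true → (b ∈³? tri τ) ≡ true →
                 ∃ λ e → ∀ v → (v ∈? edge e) ≡ (⌊ v ≟F a ⌋ ∨ ⌊ v ≟F b ⌋)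

module _ (X : Complex) where
  open Complex X

  vInE : Fin n → Fin m → Bool
  vInE v e = v ∈? edge e

  eInT : Fin m → Fin t → Bool
  eInT e τ = (Data.Product.proj₁ (edge e) ∈³? tri τ) ∧ (Data.Product.proj₂ (edge e) ∈³? tri τ)

  Regular : ℕ → ℕ → Set
  Regular k₀ k₁ = (∀ v → ∣ tabulate (λ e → vInE v e) ∣ ≡ k₀)
                × (∀ e → ∣ tabulate (λ τ → eInT e τ) ∣ ≡ k₁)

  δ₀ : Subset n → Subset m
  δ₀ S = tabulate (λ e → lookup S (Data.Product.proj₁ (edge e)) xor lookup S (Data.Product.proj₂ (edge e)))

  δ₁ : Subset m → Subset t
  δ₁ F = tabulate (λ τ → foldr (λ _ → Bool) _xor_ false (tabulate (λ e → lookup F e ∧ eInT e τ)))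

  Z⁰ : Subset n → Set
  Z⁰ S = δ₀ S ≡ ⊥

  B⁰ : Subset n → Set
  B⁰ S = (S ≡ ⊥) ⊎ (S ≡ ⊤)

  Z¹ : Subset m → Set
  Z¹ F = δ₁ F ≡ ⊥

  B¹ : Subset m → Set
  B¹ F = ∃ λ S → δ₀ S ≡ F

  localView : Subset m → Fin n → Subset m
  localView F v = tabulate (λ e → lookup F e ∧ vInE v e)

dist : {k : ℕ} → Subset k → Subset k → ℕ
dist A B = ∣ zipWith _xor_ A B ∣

-- (ε, μ)-cosystolic expansion.  The quantity dist(S, Z) is a minimum over
-- Z (= +∞ when Z is empty); "|δS| ≥ ε k dist(S,Z)" is unfolded as:
-- some C ∈ Z attains ε k dist(S,C) ≤ |δS|.
module _ (X : Complex) where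
  open Complex X

  CosystolicExpander : ℕ → ℕ → ℚ → ℚ → Set
  CosystolicExpander k₀ k₁ ε μ =
      (0ℚ < ε) × (0ℚ < μ)
    × (∀ (S : Subset n) →
         (δ₀ X S ≡ ⊥ → B⁰ X S ⊎ (μ * ℕ→ℚ n ≤ℚ ℕ→ℚ ∣ S ∣))
       × (δ₀ X S ≢ ⊥ → ∃ λ C → Z⁰ X C × (ε * ℕ→ℚ k₀ * ℕ→ℚ (dist S C) ≤ℚ ℕ→ℚ ∣ δ₀ X S ∣)))
    × (∀ (F : Subset m) →
         (δ₁ X F ≡ ⊥ → B¹ X F ⊎ (μ * ℕ→ℚ m ≤ℚ ℕ→ℚ ∣ F ∣))
       × (δ₁ X F ≢ ⊥ → ∃ λ C → Z¹ X C × (ε * ℕ→ℚ k₁ * ℕ→ℚ (dist F C) ≤ℚ ℕ→ℚ ∣ δ₁ X F ∣)))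

3/_[_] : (μ : ℚ) → 0ℚ < μ → ℚ
3/ μ [ μ>0 ] = _÷_ (ℕ→ℚ 3) μ {{>-nonZero μ>0}}

-- A nontrivial 1-cocycle C is not a coboundary, so cosystolic expansion makes it large:
-- |C| ≥ μ|E|. Double counting vertex–edge incidences gives |V| k₀ ≤ 2|E|, hence, using
-- |V| ≥ 3/μ, |C| ≥ μ |V| k₀ / 2 ≥ 3k₀/2. The local view F_v lies in the star of v, which
-- has k₀ edges, so dist(F_v, C) ≥ |C| − |F_v| ≥ 3k₀/2 − k₀ = k₀/2.
module Submission where

open import Defs
open import Algebra.Bundles using (CommutativeMonoid)
import Algebra.Properties.CommutativeMonoid.Sum as MonoidSum
import Algebra.Properties.CommutativeSemigroup as CommSemigroupProperties
open import Data.Bool using (Bool; true; false; _∧_; _∨_; _xor_)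
open import Data.Bool.Properties using (∧-conicalʳ; ∨-identityʳ)
open import Data.Empty using (⊥-elim)
open import Data.Fin using (Fin; zero; suc)
open import Data.Fin.Properties using () renaming (_≟_ to _≟F_)
open import Data.Fin.Subset using (Subset; ∣_∣; _∪_; _∈_; _⊆_; ⁅_⁆; inside; outside)
open import Data.Fin.Subset.Properties
  using (∣p∣≤∣x∷p∣; ∣q∣≤∣p∪q∣; ∣⁅x⁆∣≡1; p⊆q⇒∣p∣≤∣q∣; x∈p∪q⁺; x∈⁅y⁆⇔x≡y)
import Data.Integer as ℤ
import Data.Integer.Properties as ℤ
import Data.Nat.Coprimality as Coprimality
open import Data.Nat using (ℕ; zero; suc; _+_; _*_; _≤_; z≤n; s≤s)
open import Data.Nat.Properties
  using (≤-trans; +-mono-≤; +-monoʳ-≤; +-suc; *-monoʳ-≤; *-distribˡ-+; *-comm; +-cancelʳ-≤;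
         +-0-commutativeMonoid; module ≤-Reasoning)
open import Data.Product using (_,_; proj₁; proj₂)
open import Data.Rational as ℚ using (ℚ; mkℚ; _/_; _÷_; 0ℚ; NonZero; NonNegative)
  renaming (_≤_ to _≤ℚ_)
import Data.Rational.Properties as ℚ
open import Data.Sum using (inj₁; inj₂; _⊎_; [_,_]) renaming (map to map-⊎)
open import Data.Vec using ([]; _∷_; tabulate; lookup; zipWith)
open import Data.Vec.Properties using (lookup∘tabulate; []=⇒lookup; lookup⇒[]=)
open import Function using (_∘_; id; Equivalence)
open import Relation.Nullary using (¬_; yes; no)
open import Relation.Binary.PropositionalEquality
  using (_≡_; refl; sym; trans; cong; cong₂; subst; subst₂; module ≡-Reasoning)

private
  variable
    k : ℕ

∣p∪q∣≤∣p∣+∣q∣ : (p q : Subset k) → ∣ p ∪ q ∣ ≤ ∣ p ∣ + ∣ q ∣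
∣p∪q∣≤∣p∣+∣q∣ []            []            = z≤n
∣p∪q∣≤∣p∣+∣q∣ (inside ∷ p)  (y ∷ q)       =
  s≤s (≤-trans (∣p∪q∣≤∣p∣+∣q∣ p q) (+-monoʳ-≤ ∣ p ∣ (∣p∣≤∣x∷p∣ y q)))
∣p∪q∣≤∣p∣+∣q∣ (outside ∷ p) (inside ∷ q)  =
  subst (suc ∣ p ∪ q ∣ ≤_) (sym (+-suc ∣ p ∣ ∣ q ∣)) (s≤s (∣p∪q∣≤∣p∣+∣q∣ p q))
∣p∪q∣≤∣p∣+∣q∣ (outside ∷ p) (outside ∷ q) = ∣p∪q∣≤∣p∣+∣q∣ p q

xor-∪ : (p q : Subset k) → zipWith _xor_ p q ∪ p ≡ p ∪ q
xor-∪ []      []      = refl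
xor-∪ (x ∷ p) (y ∷ q) = cong₂ _∷_ (xor-∨ x y) (xor-∪ p q)
  where
  xor-∨ : ∀ x y → (x xor y) ∨ x ≡ x ∨ y
  xor-∨ true  true  = refl
  xor-∨ true  false = refl
  xor-∨ false y = ∨-identityʳ y

∣q∣≤dist+∣p∣ : (p q : Subset k) → ∣ q ∣ ≤ dist p q + ∣ p ∣
∣q∣≤dist+∣p∣ p q = begin
  ∣ q ∣                      ≤⟨ ∣q∣≤∣p∪q∣ p q ⟩
  ∣ p ∪ q ∣                  ≡⟨ cong ∣_∣ (sym (xor-∪ p q)) ⟩
  ∣ zipWith _xor_ p q ∪ p ∣  ≤⟨ ∣p∪q∣≤∣p∣+∣q∣ (zipWith _xor_ p q) p ⟩
  dist p q + ∣ p ∣           ∎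
  where open ≤-Reasoning

∈-tabulate⁻ : {f : Fin k → Bool} {x : Fin k} → x ∈ tabulate f → f x ≡ true
∈-tabulate⁻ {f = f} x∈ = trans (sym (lookup∘tabulate f _)) ([]=⇒lookup x∈)

∈-tabulate⁺ : {f : Fin k → Bool} {x : Fin k} → f x ≡ true → x ∈ tabulate f
∈-tabulate⁺ {f = f} fx≡true = lookup⇒[]= _ _ (trans (lookup∘tabulate f _) fx≡true)

∣pair∣≤2 : (a b : Fin k) → ∣ tabulate (_∈? (a , b)) ∣ ≤ 2
∣pair∣≤2 a b = begin
  ∣ tabulate (_∈? (a , b)) ∣  ≤⟨ p⊆q⇒∣p∣≤∣q∣ pair⊆⁅a⁆∪⁅b⁆ ⟩
  ∣ ⁅ a ⁆ ∪ ⁅ b ⁆ ∣           ≤⟨ ∣p∪q∣≤∣p∣+∣q∣ ⁅ a ⁆ ⁅ b ⁆ ⟩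
  ∣ ⁅ a ⁆ ∣ + ∣ ⁅ b ⁆ ∣       ≡⟨ cong₂ _+_ (∣⁅x⁆∣≡1 a) (∣⁅x⁆∣≡1 b) ⟩
  2                           ∎
  where
  open ≤-Reasoning
  ≡a⊎≡b : ∀ x → x ∈? (a , b) ≡ true → x ≡ a ⊎ x ≡ b
  ≡a⊎≡b x with x ≟F a | x ≟F b
  ... | yes x≡a | _       = λ _ → inj₁ x≡a
  ... | no _    | yes x≡b = λ _ → inj₂ x≡b
  ... | no _    | no _    = λ ()
  pair⊆⁅a⁆∪⁅b⁆ : tabulate (_∈? (a , b)) ⊆ ⁅ a ⁆ ∪ ⁅ b ⁆
  pair⊆⁅a⁆∪⁅b⁆ {x} x∈ = x∈p∪q⁺ (map-⊎ ≡⇒∈⁅⁆ ≡⇒∈⁅⁆ (≡a⊎≡b x (∈-tabulate⁻ x∈)))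
    where
    ≡⇒∈⁅⁆ : {x y : Fin _} → x ≡ y → x ∈ ⁅ y ⁆
    ≡⇒∈⁅⁆ = Equivalence.from x∈⁅y⁆⇔x≡y

open MonoidSum +-0-commutativeMonoid using (sum-syntax; sum; ∑-comm; sum-cong-≗)

indicator : Bool → ℕ
indicator true  = 1
indicator false = 0

∣p∣≡∑indicator : (p : Subset k) → ∣ p ∣ ≡ ∑[ i < k ] indicator (lookup p i)
∣p∣≡∑indicator []            = refl
∣p∣≡∑indicator (inside ∷ p)  = cong suc (∣p∣≡∑indicator p)
∣p∣≡∑indicator (outside ∷ p) = ∣p∣≡∑indicator p

∣tabulate∣≡∑indicator : (f : Fin k → Bool) → ∣ tabulate f ∣ ≡ ∑[ i < k ] indicator (f i)
∣tabulate∣≡∑indicator f =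
  trans (∣p∣≡∑indicator (tabulate f)) (sum-cong-≗ (cong indicator ∘ lookup∘tabulate f))

∑-mono-≤ : {f g : Fin k → ℕ} → (∀ i → f i ≤ g i) → sum f ≤ sum g
∑-mono-≤ {zero}  f≤g = z≤n
∑-mono-≤ {suc k} f≤g = +-mono-≤ (f≤g zero) (∑-mono-≤ (f≤g ∘ suc))

∑-const : ∀ k c → ∑[ i < k ] c ≡ k * c
∑-const zero    c = refl
∑-const (suc k) c = cong (c +_) (∑-const k c)

∑∣rows∣≡∑∣columns∣ : ∀ {a b} (I : Fin a → Fin b → Bool) →
  ∑[ i < a ] ∣ tabulate (I i) ∣ ≡ ∑[ j < b ] ∣ tabulate (λ i → I i j) ∣
∑∣rows∣≡∑∣columns∣ {a} {b} I = begin
  ∑[ i < a ] ∣ tabulate (I i) ∣            ≡⟨ sum-cong-≗ (λ i → ∣tabulate∣≡∑indicator (I i)) ⟩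
  ∑[ i < a ] ∑[ j < b ] indicator (I i j)  ≡⟨ ∑-comm (λ i j → indicator (I i j)) ⟩
  ∑[ j < b ] ∑[ i < a ] indicator (I i j)  ≡⟨ sum-cong-≗ (λ j → sym (∣tabulate∣≡∑indicator (λ i → I i j))) ⟩
  ∑[ j < b ] ∣ tabulate (λ i → I i j) ∣    ∎
  where open ≡-Reasoning

ℕ→ℚ≡mkℚ : ∀ a → ℕ→ℚ a ≡ mkℚ (ℤ.+ a) 0 (Coprimality.sym (Coprimality.1-coprimeTo a))
ℕ→ℚ≡mkℚ a = ℚ.normalize-coprime (Coprimality.sym (Coprimality.1-coprimeTo a))

ℕ→ℚ-mono-≤ : ∀ {a b} → a ≤ b → ℕ→ℚ a ≤ℚ ℕ→ℚ b
ℕ→ℚ-mono-≤ {a} {b} a≤b rewrite ℕ→ℚ≡mkℚ a | ℕ→ℚ≡mkℚ b =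
  ℚ.*≤* (subst₂ ℤ._≤_ (sym (ℤ.*-identityʳ (ℤ.+ a))) (sym (ℤ.*-identityʳ (ℤ.+ b))) (ℤ.+≤+ a≤b))

ℕ→ℚ-cancel-≤ : ∀ {a b} → ℕ→ℚ a ≤ℚ ℕ→ℚ b → a ≤ b
ℕ→ℚ-cancel-≤ {a} {b} rewrite ℕ→ℚ≡mkℚ a | ℕ→ℚ≡mkℚ b = λ where
  (ℚ.*≤* a*1≤b*1) → ℤ.drop‿+≤+ (subst₂ ℤ._≤_ (ℤ.*-identityʳ (ℤ.+ a)) (ℤ.*-identityʳ (ℤ.+ b)) a*1≤b*1)

ℕ→ℚ-homo-* : ∀ a b → ℕ→ℚ (a * b) ≡ ℕ→ℚ a ℚ.* ℕ→ℚ b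
ℕ→ℚ-homo-* a b rewrite ℕ→ℚ≡mkℚ a | ℕ→ℚ≡mkℚ b = cong (_/ 1) (ℤ.pos-* a b)

ℕ→ℚ-nonNeg : ∀ a → NonNegative (ℕ→ℚ a)
ℕ→ℚ-nonNeg a = ℚ.normalize-nonNeg a 1

÷≤⇒≤* : ∀ p q {r} (r>0 : 0ℚ ℚ.< r) → _÷_ p r {{ℚ.>-nonZero r>0}} ≤ℚ q → p ≤ℚ q ℚ.* r
÷≤⇒≤* p q {r} r>0 p÷r≤q = begin
  p                     ≡⟨ sym (ℚ.*-identityʳ p) ⟩
  p ℚ.* ℚ.1ℚ            ≡⟨ cong (p ℚ.*_) (sym (ℚ.*-inverseˡ r)) ⟩
  p ℚ.* (ℚ.1/ r ℚ.* r)  ≡⟨ sym (ℚ.*-assoc p (ℚ.1/ r) r) ⟩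
  p ÷ r ℚ.* r           ≤⟨ ℚ.*-monoʳ-≤-nonNeg r p÷r≤q ⟩
  q ℚ.* r               ∎
  where
  open ℚ.≤-Reasoning
  instance
    r≢0 : NonZero r
    r≢0 = ℚ.>-nonZero r>0
    r≥0 : NonNegative r
    r≥0 = ℚ.pos⇒nonNeg r {{ℚ.positive r>0}}

module _ (X : Complex) where
  open Complex X

  handshake : ∀ {k₀ k₁} → Regular X k₀ k₁ → n * k₀ ≤ 2 * m
  handshake {k₀} (deg≡k₀ , _) = begin
    n * k₀                                      ≡⟨ sym (∑-const n k₀) ⟩
    ∑[ v < n ] k₀                               ≡⟨ sum-cong-≗ (sym ∘ deg≡k₀) ⟩
    ∑[ v < n ] ∣ tabulate (vInE X v) ∣          ≡⟨ ∑∣rows∣≡∑∣columns∣ (vInE X) ⟩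
    ∑[ e < m ] ∣ tabulate (λ v → vInE X v e) ∣  ≤⟨ ∑-mono-≤ (λ e → ∣pair∣≤2 (proj₁ (edge e)) (proj₂ (edge e))) ⟩
    ∑[ e < m ] 2                                ≡⟨ ∑-const m 2 ⟩
    m * 2                                       ≡⟨ *-comm m 2 ⟩
    2 * m                                       ∎
    where open ≤-Reasoning

  ∣localView∣≤deg : (F : Subset m) (v : Fin n) → ∣ localView X F v ∣ ≤ ∣ tabulate (vInE X v) ∣
  ∣localView∣≤deg F v = p⊆q⇒∣p∣≤∣q∣ localView⊆star
    where
    localView⊆star : localView X F v ⊆ tabulate (vInE X v)
    localView⊆star = ∈-tabulate⁺ ∘ ∧-conicalʳ _ _ ∘ ∈-tabulate⁻ {f = λ e → lookup F e ∧ vInE X v e}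

  nontrivialCocycle-large : ∀ {k₀ k₁ ε μ} → CosystolicExpander X k₀ k₁ ε μ →
    (C : Subset m) → Z¹ X C → ¬ B¹ X C → μ ℚ.* ℕ→ℚ m ≤ℚ ℕ→ℚ ∣ C ∣
  nontrivialCocycle-large (_ , _ , _ , cosystolic₁) C C∈Z¹ C∉B¹ =
    [ ⊥-elim ∘ C∉B¹ , id ] (proj₁ (cosystolic₁ C) C∈Z¹)

  nontrivialCocycle-lowerBound : ∀ {k₀ k₁ ε μ} → Regular X k₀ k₁ →
    (exp : CosystolicExpander X k₀ k₁ ε μ) → 3/ μ [ proj₁ (proj₂ exp) ] ≤ℚ ℕ→ℚ n →
    (C : Subset m) → Z¹ X C → ¬ B¹ X C → 3 * k₀ ≤ 2 * ∣ C ∣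
  nontrivialCocycle-lowerBound {k₀} {k₁} {ε} {μ} reg exp 3/μ≤n C C∈Z¹ C∉B¹ = ℕ→ℚ-cancel-≤ (begin
    ℕ→ℚ (3 * k₀)              ≡⟨ ℕ→ℚ-homo-* 3 k₀ ⟩
    ℕ→ℚ 3 ℚ.* ℕ→ℚ k₀          ≤⟨ ℚ.*-monoʳ-≤-nonNeg (ℕ→ℚ k₀) {{ℕ→ℚ-nonNeg k₀}} (÷≤⇒≤* (ℕ→ℚ 3) (ℕ→ℚ n) μ>0 3/μ≤n) ⟩
    (ℕ→ℚ n ℚ.* μ) ℚ.* ℕ→ℚ k₀  ≡⟨ xy∙z≈y∙xz (ℕ→ℚ n) μ (ℕ→ℚ k₀) ⟩
    μ ℚ.* (ℕ→ℚ n ℚ.* ℕ→ℚ k₀)  ≡⟨ cong (μ ℚ.*_) (sym (ℕ→ℚ-homo-* n k₀)) ⟩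
    μ ℚ.* ℕ→ℚ (n * k₀)        ≤⟨ ℚ.*-monoˡ-≤-nonNeg μ {{μ≥0}} (ℕ→ℚ-mono-≤ (handshake reg)) ⟩
    μ ℚ.* ℕ→ℚ (2 * m)         ≡⟨ cong (μ ℚ.*_) (ℕ→ℚ-homo-* 2 m) ⟩
    μ ℚ.* (ℕ→ℚ 2 ℚ.* ℕ→ℚ m)   ≡⟨ x∙yz≈y∙xz μ (ℕ→ℚ 2) (ℕ→ℚ m) ⟩
    ℕ→ℚ 2 ℚ.* (μ ℚ.* ℕ→ℚ m)   ≤⟨ ℚ.*-monoˡ-≤-nonNeg (ℕ→ℚ 2) {{ℕ→ℚ-nonNeg 2}} μm≤∣C∣ ⟩
    ℕ→ℚ 2 ℚ.* ℕ→ℚ ∣ C ∣       ≡⟨ sym (ℕ→ℚ-homo-* 2 ∣ C ∣) ⟩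
    ℕ→ℚ (2 * ∣ C ∣)           ∎)
    where
    open ℚ.≤-Reasoning
    open CommSemigroupProperties (CommutativeMonoid.commutativeSemigroup ℚ.*-1-commutativeMonoid)
    μ>0 : 0ℚ ℚ.< μ
    μ>0 = proj₁ (proj₂ exp)
    μ≥0 : NonNegative μ
    μ≥0 = ℚ.pos⇒nonNeg μ {{ℚ.positive μ>0}}
    μm≤∣C∣ : μ ℚ.* ℕ→ℚ m ≤ℚ ℕ→ℚ ∣ C ∣
    μm≤∣C∣ = nontrivialCocycle-large {k₀} {k₁} {ε} exp C C∈Z¹ C∉B¹

lemma3p6 : (X : Complex) (k₀ k₁ : ℕ) (ε μ : ℚ) →
             Regular X k₀ k₁ →
             (exp : CosystolicExpander X k₀ k₁ ε μ) →
             3/ μ [ proj₁ (proj₂ exp) ] ≤ℚ ℕ→ℚ (Complex.n X) →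
             (F : Subset (Complex.m X)) (v : Fin (Complex.n X)) →
             (C : Subset (Complex.m X)) → Z¹ X C → ¬ B¹ X C →
             k₀ ≤ 2 * dist (localView X F v) C
lemma3p6 X k₀ k₁ ε μ reg exp 3/μ≤n F v C C∈Z¹ C∉B¹ = +-cancelʳ-≤ (2 * k₀) k₀ (2 * d) (begin
  k₀ + 2 * k₀     ≤⟨ nontrivialCocycle-lowerBound X {k₀} {k₁} reg exp 3/μ≤n C C∈Z¹ C∉B¹ ⟩
  2 * ∣ C ∣       ≤⟨ *-monoʳ-≤ 2 ∣C∣≤d+k₀ ⟩
  2 * (d + k₀)    ≡⟨ *-distribˡ-+ 2 d k₀ ⟩
  2 * d + 2 * k₀  ∎)
  where
  open ≤-Reasoning
  d : ℕ
  d = dist (localView X F v) C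
  ∣C∣≤d+k₀ : ∣ C ∣ ≤ d + k₀
  ∣C∣≤d+k₀ = ≤-trans (∣q∣≤dist+∣p∣ (localView X F v) C)
                     (+-monoʳ-≤ d (subst (∣ localView X F v ∣ ≤_) (proj₁ reg v) (∣localView∣≤deg X F v)))
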